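{- Let $\overline\Gamma$ be a subgroup of $\mathrm{PSL}_2(\mathbb Z)$ which has a noncongruence lift to $\mathrm{SL}_2(\mathbb Z)$. Then every subgroup $\overline G\le\overline\Gamma$ has a noncongruence lift.
   Context: A lift of a subgroup $\overline\Gamma\le\mathrm{PSL}_2(\mathbb Z)$ is a subgroup of $\mathrm{SL}_2(\mathbb Z)$ whose image in $\mathrm{PSL}_2(\mathbb Z)$ equals $\overline\Gamma$. A subgroup of $\mathrm{SL}_2(\mathbb Z)$ is a congruence subgroup if it contains $\Gamma(M)=\{A\in\mathrm{SL}_2(\mathbb Z):A\equiv1\pmod M\}$ for some $M\in\mathbb N$; a noncongruence lift is a lift that is not a congruence subgroup. -}

module Defs where

open import Data.Nat using (ℕ; _≥_)
open import Data.Integer using (ℤ; +_; _+_; _-_; _*_; -_)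
open import Data.Integer.Divisibility using (_∣_)
open import Data.Product using (Σ; _×_)
open import Data.Sum using (_⊎_)
open import Relation.Nullary using (¬_)
open import Relation.Binary.PropositionalEquality using (_≡_)

record Mat : Set where
  constructor mat
  field
    a b c d : ℤ
open Mat public

det : Mat → ℤ
det (mat a b c d) = a * d - b * c

I₂ : Mat
I₂ = mat (+ 1) (+ 0) (+ 0) (+ 1)

_·_ : Mat → Mat → Mat
mat a₁ b₁ c₁ d₁ · mat a₂ b₂ c₂ d₂ =
  mat (a₁ * a₂ + b₁ * c₂) (a₁ * b₂ + b₁ * d₂) (c₁ * a₂ + d₁ * c₂) (c₁ * b₂ + d₁ * d₂)

-- inverse of a determinant-one matrix (adjugate)
inv : Mat → Mat
inv (mat a b c d) = mat d (- b) (- c) a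

neg : Mat → Mat
neg (mat a b c d) = mat (- a) (- b) (- c) (- d)

Subset : Set₁
Subset = Mat → Set

_⊆_ : Subset → Subset → Set
P ⊆ Q = ∀ A → P A → Q A

record IsSL2Subgroup (G : Subset) : Set where
  field
    inSL2  : ∀ A → G A → det A ≡ + 1
    hasId  : G I₂
    mulCl  : ∀ A B → G A → G B → G (A · B)
    invCl  : ∀ A → G A → G (inv A)

-- Subgroups of PSL₂(ℤ) = SL₂(ℤ)/{±1} are represented by their full preimages
-- in SL₂(ℤ): a subset of PSL₂(ℤ) is a ±-invariant subset of SL₂(ℤ), and it is a
-- subgroup of PSL₂(ℤ) iff its preimage is a subgroup of SL₂(ℤ).
record IsPSL2Subgroup (P : Subset) : Set where
  field
    preimageSubgroup : IsSL2Subgroup P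
    negCl            : ∀ A → P A → P (neg A)

-- Γ is a lift of Γ̄: Γ is a subgroup of SL₂(ℤ) whose image in PSL₂(ℤ) is Γ̄,
-- i.e. the class ±A lies in Γ̄ iff A ∈ Γ or -A ∈ Γ.
record IsLift (Γ : Subset) (Γ̄ : Subset) : Set where
  field
    subgroup : IsSL2Subgroup Γ
    image→   : ∀ A → Γ̄ A → Γ A ⊎ Γ (neg A)
    image←   : ∀ A → Γ A ⊎ Γ (neg A) → Γ̄ A

_≡I[mod_] : Mat → ℕ → Set
mat a b c d ≡I[mod M ] =
  ((+ M) ∣ (a - + 1)) × ((+ M) ∣ b) × ((+ M) ∣ c) × ((+ M) ∣ (d - + 1))

PrincipalCong : ℕ → Subset
PrincipalCong M A = (det A ≡ + 1) × (A ≡I[mod M ])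

IsCongruence : Subset → Set
IsCongruence G = Σ ℕ λ M → (M ≥ 1) × (PrincipalCong M ⊆ G)

HasNoncongruenceLift : Subset → Set₁
HasNoncongruenceLift Γ̄ = Σ Subset λ Γ → IsLift Γ Γ̄ × ¬ IsCongruence Γ

{-# OPTIONS --safe #-}
-- If Γ is a noncongruence lift of Γ̄ and Ḡ ≤ Γ̄, then Γ ∩ π⁻¹(Ḡ) is a lift of Ḡ
-- (π : SL₂(ℤ) → PSL₂(ℤ)), and it is noncongruence because a subgroup containing
-- a congruence subgroup is itself congruence.
module Submission where

open import Defs
open import Data.Integer.Properties using (neg-involutive)
open import Data.Product using (_×_; _,_; proj₁; proj₂)
open import Data.Sum using (_⊎_; inj₁; inj₂)
open import Function using (_∘_)
open import Relation.Binary.PropositionalEquality using (_≡_; refl; subst)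

_∩_ : Subset → Subset → Subset
(P ∩ Q) A = P A × Q A

neg-involutive-Mat : ∀ A → neg (neg A) ≡ A
neg-involutive-Mat (mat a b c d)
  rewrite neg-involutive a | neg-involutive b | neg-involutive c | neg-involutive d = refl

∩-isSL2Subgroup : ∀ {G H} → IsSL2Subgroup G → IsSL2Subgroup H → IsSL2Subgroup (G ∩ H)
∩-isSL2Subgroup G H = record
  { inSL2 = λ A x → G.inSL2 A (proj₁ x)
  ; hasId = G.hasId , H.hasId
  ; mulCl = λ A B x y → G.mulCl A B (proj₁ x) (proj₁ y) , H.mulCl A B (proj₂ x) (proj₂ y)
  ; invCl = λ A x → G.invCl A (proj₁ x) , H.invCl A (proj₂ x)
  }
  where
  module G = IsSL2Subgroup G
  module H = IsSL2Subgroup H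

∩-isLift : ∀ {Γ Γ̄ Ḡ} → IsLift Γ Γ̄ → IsPSL2Subgroup Ḡ → Ḡ ⊆ Γ̄ → IsLift (Γ ∩ Ḡ) Ḡ
∩-isLift {Γ} {Γ̄} {Ḡ} Γ-lift Ḡ-psl Ḡ⊆Γ̄ = record
  { subgroup = ∩-isSL2Subgroup (IsLift.subgroup Γ-lift) (IsPSL2Subgroup.preimageSubgroup Ḡ-psl)
  ; image→   = image→
  ; image←   = image←
  }
  where
  negCl : ∀ A → Ḡ A → Ḡ (neg A)
  negCl = IsPSL2Subgroup.negCl Ḡ-psl

  image→ : ∀ A → Ḡ A → (Γ ∩ Ḡ) A ⊎ (Γ ∩ Ḡ) (neg A)
  image→ A A∈Ḡ with IsLift.image→ Γ-lift A (Ḡ⊆Γ̄ A A∈Ḡ)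
  ... | inj₁ A∈Γ  = inj₁ (A∈Γ , A∈Ḡ)
  ... | inj₂ -A∈Γ = inj₂ (-A∈Γ , negCl A A∈Ḡ)

  image← : ∀ A → (Γ ∩ Ḡ) A ⊎ (Γ ∩ Ḡ) (neg A) → Ḡ A
  image← A (inj₁ (_ , A∈Ḡ))  = A∈Ḡ
  image← A (inj₂ (_ , -A∈Ḡ)) = subst Ḡ (neg-involutive-Mat A) (negCl (neg A) -A∈Ḡ)

⊆-isCongruence : ∀ {G H} → G ⊆ H → IsCongruence G → IsCongruence H
⊆-isCongruence G⊆H (M , M≥1 , Γ[M]⊆G) = M , M≥1 , λ A A∈Γ[M] → G⊆H A (Γ[M]⊆G A A∈Γ[M])

lemma2p2 : (Γ̄ : Subset) → IsPSL2Subgroup Γ̄ → HasNoncongruenceLift Γ̄ →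
    (Ḡ : Subset) → IsPSL2Subgroup Ḡ → Ḡ ⊆ Γ̄ → HasNoncongruenceLift Ḡ
lemma2p2 Γ̄ _ (Γ , Γ-lift , Γ-noncong) Ḡ Ḡ-psl Ḡ⊆Γ̄ =
  Γ ∩ Ḡ , ∩-isLift Γ-lift Ḡ-psl Ḡ⊆Γ̄ , Γ-noncong ∘ ⊆-isCongruence (λ _ → proj₁)
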